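{- Let $G$ be a graph and $k$ an integer with $k < \Delta(G)+1$. If there is a partial proper $k$-colouring of $G$ (with colours from $\{1,\dots,k\}$) such that for every vertex $u \in V(G)$, $\mathrm{Col}(u) - \mathrm{Dist}(u) \geq d(u) + 1 - k$, then $G$ has a (proper) $k$-colouring.
   Context: A partial proper $k$-colouring assigns colours from $\{1,\dots,k\}$ to some of the vertices so that adjacent coloured vertices receive different colours. For a vertex $u$, $\mathrm{Col}(u)$ is the number of coloured vertices in $N(u)$, $\mathrm{Dist}(u)$ is the number of distinct colours appearing on the vertices of $N(u)$, and $d(u)$ is the degree of $u$. -}

module Defs where

open import Data.Nat using (ℕ; zero; suc; _⊔_)
open import Data.Fin using (Fin)
open import Data.Maybe using (Maybe; just; nothing)
open import Data.List using (List; foldr; map; filter; length)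
open import Data.List using () renaming (length to len)
open import Data.Fin.Base using ()
open import Data.List.Base using (allFin)
open import Data.Product using (Σ; _×_; ∃-syntax)
open import Relation.Nullary using (¬_; Dec; yes; no)
open import Relation.Unary using (Decidable)
open import Relation.Binary.PropositionalEquality using (_≡_)
open import Data.Maybe.Properties using () renaming (≡-dec to maybe-≡-dec)
open import Data.Fin.Properties using () renaming (_≟_ to _≟ᶠ_)
open import Data.List.Relation.Unary.Any using (any?)
open import Data.Empty using (⊥)

record Graph (n : ℕ) : Set₁ where
  field
    Adj     : Fin n → Fin n → Set
    Adj?    : (u v : Fin n) → Dec (Adj u v)
    sym     : ∀ {u v} → Adj u v → Adj v u
    irrefl  : ∀ {u} → ¬ Adj u u
open Graph public

N : ∀ {n} (G : Graph n) → Fin n → List (Fin n)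
N G u = filter (Adj? G u) (allFin _)

deg : ∀ {n} (G : Graph n) → Fin n → ℕ
deg G u = length (N G u)

Δ : ∀ {n} (G : Graph n) → ℕ
Δ G = foldr _⊔_ 0 (map (deg G) (allFin _))

-- A partial k-colouring: each vertex gets a colour from Fin k (i.e. {1..k}) or is uncoloured.
PartialColouring : ℕ → ℕ → Set
PartialColouring n k = Fin n → Maybe (Fin k)

IsProperPartial : ∀ {n k} (G : Graph n) → PartialColouring n k → Set
IsProperPartial G c = ∀ u v → Adj G u v → (x : _) → c u ≡ just x → c v ≡ just x → ⊥

isColoured? : ∀ {n k} (c : PartialColouring n k) → Decidable (λ v → ¬ (c v ≡ nothing))
isColoured? c v with c v
... | nothing = no (λ f → f _≡_.refl)
... | just _  = yes (λ ())

Col : ∀ {n k} (G : Graph n) → PartialColouring n k → Fin n → ℕ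
Col G c u = length (filter (isColoured? c) (N G u))

Dist : ∀ {n k} (G : Graph n) → PartialColouring n k → Fin n → ℕ
Dist {k = k} G c u =
  length (filter (λ x → any? (λ v → maybe-≡-dec _≟ᶠ_ (c v) (just x)) (N G u)) (allFin k))

IsProperColouring : ∀ {n k} (G : Graph n) → (Fin n → Fin k) → Set
IsProperColouring G f = ∀ u v → Adj G u v → ¬ (f u ≡ f v)

module Submission where

-- Proof idea: colour the uncoloured vertices greedily, one at a time, always
-- keeping a proper partial colouring c′ that extends the given colouring c.
-- When an uncoloured vertex u is treated, every colour on a neighbour of u
-- under c′ is
--   * either a colour that c already puts on N(u)      (at most Dist(u) of them),
--   * or a colour that c′ put on a neighbour c left uncoloured
--                                                     (at most d(u) − Col(u)).
-- The hypothesis d(u) + 1 + Dist(u) ≤ Col(u) + k says these are fewer than k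
-- colours, so by the pigeonhole principle some colour is free at u.

open import Defs
open import Data.Nat using (ℕ; _+_; _<_; _≤_; suc; s≤s)
open import Data.Nat.Properties
  using (+-suc; +-assoc; +-comm; +-monoʳ-≤; +-cancelˡ-≤; module ≤-Reasoning)
open import Data.Bool using (true; false)
open import Data.Fin using (Fin)
open import Data.Fin.Properties using (¬∀⟶∃¬; pigeonhole; <⇒≢) renaming (_≟_ to _≟ᶠ_)
open import Data.Product using (Σ; ∃; _×_; _,_; proj₁; proj₂)
open import Data.Maybe using (just; nothing)
open import Data.Maybe.Properties using (just-injective) renaming (≡-dec to maybe-≡-dec)
import Data.Maybe.Relation.Unary.Any as MaybeAny
open import Data.List using (List; []; _∷_; _++_; length; filter; lookup; allFin; mapMaybe)
open import Data.List.Properties using (length-++; length-mapMaybe)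
open import Data.List.Relation.Unary.Any using (here; there; index; any?)
import Data.List.Relation.Unary.Any as Any
open import Data.List.Relation.Unary.Any.Properties using (lookup-index; mapMaybe⁺; map⁺)
open import Data.List.Membership.Propositional using (_∈_; _∉_; lose)
open import Data.List.Membership.Propositional.Properties
  using (∈-filter⁺; ∈-allFin; ∈-++⁺ˡ; ∈-++⁺ʳ)
import Data.List.Membership.DecPropositional as DecMembership
open import Relation.Nullary using (¬_; yes; no; does; contradiction)
open import Relation.Unary using (Pred; Decidable)
open import Relation.Unary.Properties using (∁?)
open import Relation.Binary.PropositionalEquality
  using (_≡_; _≢_; refl; trans; cong; subst)
  renaming (sym to ≡-sym)

missing : ∀ {k} (L : List (Fin k)) → length L < k → ∃ λ x → x ∉ L
missing {k} L short = ¬∀⟶∃¬ k (_∈ L) (_∈? L) covers⇒long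
  where
  open DecMembership (_≟ᶠ_ {k}) using (_∈?_)
  -- A list covering Fin k has length at least k: otherwise the positions of
  -- two distinct elements would coincide.
  covers⇒long : ¬ (∀ x → x ∈ L)
  covers⇒long all with pigeonhole short (λ x → index (all x))
  ... | i , j , i<j , same-index =
    <⇒≢ i<j (trans (lookup-index (all i))
              (trans (cong (lookup L) same-index) (≡-sym (lookup-index (all j)))))

length-filter-∁ : ∀ {a p} {A : Set a} {P : Pred A p} (P? : Decidable P) (xs : List A) →
  length (filter P? xs) + length (filter (∁? P?) xs) ≡ length xs
length-filter-∁ P? [] = refl
length-filter-∁ P? (x ∷ xs) with does (P? x)
... | true  = cong suc (length-filter-∁ P? xs)
... | false = trans (+-suc _ _) (cong suc (length-filter-∁ P? xs))

budget : ∀ a b d e k → a + b ≤ d → suc d + e ≤ a + k → e + b < k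
budget a b d e k a+b≤d within = +-cancelˡ-≤ a _ _ (begin
  a + suc (e + b)   ≡⟨ +-suc a (e + b) ⟩
  suc (a + (e + b)) ≡⟨ cong suc (swap-front a e b) ⟩
  suc (e + (a + b)) ≤⟨ s≤s (+-monoʳ-≤ e a+b≤d) ⟩
  suc (e + d)       ≡⟨ cong suc (+-comm e d) ⟩
  suc d + e         ≤⟨ within ⟩
  a + k             ∎)
  where
  open ≤-Reasoning
  swap-front : ∀ x y z → x + (y + z) ≡ y + (x + z)
  swap-front x y z = trans (≡-sym (+-assoc x y z))
                     (trans (cong (_+ z) (+-comm x y)) (+-assoc y x z))

module _ {n k : ℕ} where

  Coloured : PartialColouring n k → Fin n → Set
  Coloured c v = ∃ λ y → c v ≡ just y

  _⊑_ : PartialColouring n k → PartialColouring n k → Set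
  c ⊑ c′ = ∀ v {y} → c v ≡ just y → c′ v ≡ just y

  ⊑-refl : ∀ {c} → c ⊑ c
  ⊑-refl v cv = cv

  ⊑-trans : ∀ {c c′ c″} → c ⊑ c′ → c′ ⊑ c″ → c ⊑ c″
  ⊑-trans c⊑c′ c′⊑c″ v cv = c′⊑c″ v (c⊑c′ v cv)

  ⊑-coloured : ∀ {c c′ v} → c ⊑ c′ → Coloured c v → Coloured c′ v
  ⊑-coloured {v = v} c⊑c′ (y , cv) = y , c⊑c′ v cv

  _[_↦_] : PartialColouring n k → Fin n → Fin k → PartialColouring n k
  (c [ u ↦ x ]) w with w ≟ᶠ u
  ... | yes _ = just x
  ... | no _  = c w

  assign-colours : ∀ c u x → Coloured (c [ u ↦ x ]) u
  assign-colours c u x with u ≟ᶠ u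
  ... | yes _  = x , refl
  ... | no u≢u = contradiction refl u≢u

  assign-extends : ∀ {c u} x → c u ≡ nothing → c ⊑ (c [ u ↦ x ])
  assign-extends {c} {u} x cu≡nothing w cw with w ≟ᶠ u
  ... | yes refl = contradiction (trans (≡-sym cu≡nothing) cw) λ ()
  ... | no _     = cw

  newColours : (c c′ : PartialColouring n k) → List (Fin n) → List (Fin k)
  newColours c c′ vs = mapMaybe c′ (filter (∁? (isColoured? c)) vs)

  newColours-∈ : ∀ c c′ {vs v x} → v ∈ vs → c v ≡ nothing → c′ v ≡ just x →
                 x ∈ newColours c c′ vs
  newColours-∈ c c′ {vs} {v} {x} v∈vs cv c′v =
    mapMaybe⁺ c′ _ (map⁺ (Any.map carries-x uncoloured-∈))
    where
    uncoloured-∈ : v ∈ filter (∁? (isColoured? c)) vs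
    uncoloured-∈ = ∈-filter⁺ (∁? (isColoured? c)) v∈vs (λ coloured → coloured cv)
    carries-x : ∀ {w} → v ≡ w → MaybeAny.Any (x ≡_) (c′ w)
    carries-x refl rewrite c′v = MaybeAny.just refl

  -- Every member of vs is coloured by c or contributes at most one new colour.
  newColours-length : ∀ c c′ vs →
    length (filter (isColoured? c) vs) + length (newColours c c′ vs) ≤ length vs
  newColours-length c c′ vs = begin
    length (filter (isColoured? c) vs) + length (newColours c c′ vs)
      ≤⟨ +-monoʳ-≤ _ (length-mapMaybe c′ (filter (∁? (isColoured? c)) vs)) ⟩
    length (filter (isColoured? c) vs) + length (filter (∁? (isColoured? c)) vs)
      ≡⟨ length-filter-∁ (isColoured? c) vs ⟩
    length vs ∎
    where open ≤-Reasoning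

module _ {n k : ℕ} (G : Graph n) where

  neighbour-∈ : ∀ {u v} → Adj G u v → v ∈ N G u
  neighbour-∈ {u} {v} adj = ∈-filter⁺ (Adj? G u) (∈-allFin v) adj

  FreeAt : PartialColouring n k → Fin n → Fin k → Set
  FreeAt c u x = ∀ v → Adj G u v → c v ≢ just x

  assign-proper : ∀ {c u x} → IsProperPartial G c → FreeAt c u x →
                  IsProperPartial G (c [ u ↦ x ])
  assign-proper {c} {u} {x} proper free v w adj y cv cw with v ≟ᶠ u | w ≟ᶠ u
  ... | yes refl | yes refl = Graph.irrefl G adj
  ... | yes refl | no _     rewrite just-injective cv = free w adj cw
  ... | no _     | yes refl rewrite just-injective cw = free v (Graph.sym G adj) cv
  ... | no _     | no _     = proper v w adj y cv cw

  -- The colours that c uses on N(u); its length is Dist(u) by definition.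
  usedColours : PartialColouring n k → Fin n → List (Fin k)
  usedColours c u =
    filter (λ x → any? (λ v → maybe-≡-dec _≟ᶠ_ (c v) (just x)) (N G u)) (allFin k)

  usedColours-∈ : ∀ c {u v x} → Adj G u v → c v ≡ just x → x ∈ usedColours c u
  usedColours-∈ c {x = x} adj cv = ∈-filter⁺ _ (∈-allFin x) (lose (neighbour-∈ adj) cv)

  totalise : ∀ c → IsProperPartial G c → (∀ v → Coloured c v) →
             Σ (Fin n → Fin k) (IsProperColouring G)
  totalise c proper coloured = colour , colour-proper
    where
    colour : Fin n → Fin k
    colour v = proj₁ (coloured v)
    colour-proper : IsProperColouring G colour
    colour-proper u v adj same = proper u v adj (colour u) (proj₂ (coloured u))
      (trans (proj₂ (coloured v)) (cong just (≡-sym same)))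

  forbidden : (c c′ : PartialColouring n k) → Fin n → List (Fin k)
  forbidden c c′ u = usedColours c u ++ newColours c c′ (N G u)

  forbidden-complete : ∀ {c c′ u v x} → c ⊑ c′ → Adj G u v → c′ v ≡ just x →
                       x ∈ forbidden c c′ u
  forbidden-complete {c} {c′} {u} {v} c⊑c′ adj c′v with c v in cv
  ... | nothing = ∈-++⁺ʳ (usedColours c u) (newColours-∈ c c′ (neighbour-∈ adj) cv c′v)
  ... | just y  = ∈-++⁺ˡ (usedColours-∈ c adj (trans cv (trans (≡-sym (c⊑c′ v cv)) c′v)))

  -- The hypothesis of the theorem at u says exactly that fewer than k colours
  -- are forbidden at u: Dist(u) + (d(u) − Col(u)) < k.
  forbidden-short : ∀ c c′ u → suc (deg G u) + Dist G c u ≤ Col G c u + k →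
                    length (forbidden c c′ u) < k
  forbidden-short c c′ u room =
    subst (_< k) (≡-sym (length-++ (usedColours c u)))
      (budget (Col G c u) _ (deg G u) (Dist G c u) k (newColours-length c c′ (N G u)) room)

  free-colour : ∀ {c c′} u → c ⊑ c′ → suc (deg G u) + Dist G c u ≤ Col G c u + k →
                ∃ (FreeAt c′ u)
  free-colour {c} {c′} u c⊑c′ room with missing (forbidden c c′ u) (forbidden-short c c′ u room)
  ... | x , x∉ = x , λ v adj c′v → x∉ (forbidden-complete c⊑c′ adj c′v)

module Greedy {n k : ℕ} (G : Graph n) (c : PartialColouring n k)
  (c-proper : IsProperPartial G c)
  (room : (u : Fin n) → suc (deg G u) + Dist G c u ≤ Col G c u + k) where

  record ProperExtension : Set where
    field
      colouring : PartialColouring n k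
      extends   : c ⊑ colouring
      proper    : IsProperPartial G colouring
  open ProperExtension

  colourVertex : (E : ProperExtension) (u : Fin n) →
    Σ ProperExtension λ E′ → colouring E ⊑ colouring E′ × Coloured (colouring E′) u
  colourVertex E u with colouring E u in cu
  ... | just y  = E , ⊑-refl , (y , cu)
  ... | nothing with free-colour G u (extends E) (room u)
  ... | x , free =
    record { colouring = colouring E [ u ↦ x ]
           ; extends   = ⊑-trans (extends E) (assign-extends x cu)
           ; proper    = assign-proper G (proper E) free }
    , assign-extends x cu , assign-colours (colouring E) u x

  colourAll : (vs : List (Fin n)) →
    Σ ProperExtension λ E → ∀ {v} → v ∈ vs → Coloured (colouring E) v
  colourAll [] = record { colouring = c ; extends = ⊑-refl ; proper = c-proper } , λ ()
  colourAll (u ∷ us) with colourAll us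
  ... | E , covered with colourVertex E u
  ... | E′ , E⊑E′ , u-coloured = E′ , covers
    where
    covers : ∀ {v} → v ∈ u ∷ us → Coloured (colouring E′) v
    covers (here refl) = u-coloured
    covers (there v∈us) = ⊑-coloured E⊑E′ (covered v∈us)

proposition3p1 : (n : ℕ) (G : Graph n) (k : ℕ) → k < suc (Δ G) →
    (c : PartialColouring n k) → IsProperPartial G c →
    ((u : Fin n) → suc (deg G u) + Dist G c u ≤ Col G c u + k) →
    Σ (Fin n → Fin k) (λ f → IsProperColouring G f)
proposition3p1 n G k _ c c-proper room =
  totalise G (colouring E) (proper E) (λ v → all-coloured (∈-allFin v))
  where
  open Greedy G c c-proper room
  open ProperExtension
  greedy : Σ ProperExtension λ E → ∀ {v} → v ∈ allFin n → Coloured (colouring E) v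
  greedy = colourAll (allFin n)
  E : ProperExtension
  E = proj₁ greedy
  all-coloured : ∀ {v} → v ∈ allFin n → Coloured (colouring E) v
  all-coloured = proj₂ greedy
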